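{- For every primary-colored part $l_p\in\mathcal{P}$ and every secondary-colored part $k_q\in\mathcal{S}$: (i) $l_p\gg k_q$ fails if and only if $(k+1)_q\gg(l-1)_p$; (ii) $l_p\gg\alpha(k_q)$ if and only if $\beta((k+1)_q)\not\succ(l-1)_p$.
   Context: Primary colors $a_1<\cdots<a_n$; secondary colors $a_ia_j$ ($i<j$); total order $a_1a_2<\cdots<a_1a_n<a_1<a_2a_3<\cdots<a_2a_n<a_2<\cdots<a_{n-1}a_n<a_{n-1}<a_n$. A part $k_p$ has integer size $k$ and color $p$. $k_p\succ l_q$ iff $k-l\ge\chi(p\le q)$ ($\chi$ the indicator); $k_p\succeq l_q$ iff $k_p\succ l_q$ or equality. Special pairs: $(a_ka_l,a_ia_j)$ with $i<j<k<l$ or $k<i<j<l$. $\mathcal{P}$: parts with primary color and positive size; $\mathcal{S}$: parts with secondary color and size $\ge2$. The relation $\gg$ (on colored parts) is: $k_p\gg l_q$ iff $k_p\succeq(l+1)_q$ when $p$ or $q$ is primary; $k_p\succ(l+1)_q$ when both are secondary and $(p,q)$ is not special; $k_p\succ l_q$ when $(p,q)$ is special. Halves: for $k\ge0$, $\alpha((2k)_{a_ia_j})=k_{a_j}$, $\beta((2k)_{a_ia_j})=k_{a_i}$, $\alpha((2k+1)_{a_ia_j})=(k+1)_{a_i}$, $\beta((2k+1)_{a_ia_j})=k_{a_j}$. -}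

module Defs where

open import Data.Nat as ℕ using (ℕ; zero; suc; _<ᵇ_; _≤ᵇ_; _≡ᵇ_)
open import Data.Nat.DivMod using (_/_; _%_)
open import Data.Integer as ℤ using (ℤ; +_; _-_; _≤_)
open import Data.Fin as Fin using (Fin; toℕ)
open import Data.Bool using (Bool; true; false; _∧_; _∨_; if_then_else_)
open import Data.Product using (_×_; _,_)
open import Data.Sum using (_⊎_)
open import Relation.Nullary using (¬_)
open import Relation.Binary.PropositionalEquality using (_≡_)

-- Colors over primaries a_1 < ... < a_n, represented by Fin n (a_{i+1} ↔ i).
-- Secondary color a_i a_j requires i < j.
data Color (n : ℕ) : Set where
  prim : Fin n → Color n
  sec  : (i j : Fin n) → i Fin.< j → Color n

-- Position key realising the total order
-- a1a2 < ... < a1an < a1 < a2a3 < ... < a2an < a2 < ... < a_{n-1}a_n < a_{n-1} < a_n :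
-- a_i a_j ↦ (i , j), a_i ↦ (i , n), compared lexicographically.
key : ∀ {n} → Color n → ℕ × ℕ
key {n} (prim i)    = toℕ i , n
key     (sec i j _) = toℕ i , toℕ j

_≤ᶜ_ : ∀ {n} → Color n → Color n → Bool
p ≤ᶜ q with key p | key q
... | a , b | c , d = (a <ᵇ c) ∨ ((a ≡ᵇ c) ∧ (b ≤ᵇ d))

χ : ∀ {n} → Color n → Color n → ℤ
χ p q = if p ≤ᶜ q then + 1 else + 0

record Part (n : ℕ) : Set where
  constructor _at_
  field
    size  : ℤ
    color : Color n
open Part public

_≻_ : ∀ {n} → Part n → Part n → Set
(k at p) ≻ (l at q) = χ p q ≤ k - l

_⪰_ : ∀ {n} → Part n → Part n → Set
x ⪰ y = x ≻ y ⊎ x ≡ y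

Special : ∀ {n} → Color n → Color n → Set
Special (sec k l _) (sec i j _) =
  (i Fin.< j × j Fin.< k × k Fin.< l) ⊎ (k Fin.< i × i Fin.< j × j Fin.< l)
Special _ _ = Data.Empty.⊥
  where import Data.Empty

_≫_ : ∀ {n} → Part n → Part n → Set
(k at prim p) ≫ (l at q) = (k at prim p) ⪰ ((l ℤ.+ + 1) at q)
(k at sec i j h) ≫ (l at prim q) = (k at sec i j h) ⪰ ((l ℤ.+ + 1) at prim q)
(k at sec i j h) ≫ (l at sec i' j' h') =
  (¬ Special (sec i j h) (sec i' j' h') × (k at sec i j h) ≻ ((l ℤ.+ + 1) at sec i' j' h'))
  ⊎ (Special (sec i j h) (sec i' j' h') × (k at sec i j h) ≻ (l at sec i' j' h'))

α : ∀ {n} → ℕ → (i j : Fin n) → Part n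
α m i j with m % 2
... | zero  = (+ (m / 2)) at prim j
... | suc _ = (+ suc (m / 2)) at prim i

β : ∀ {n} → ℕ → (i j : Fin n) → Part n
β m i j with m % 2
... | zero  = (+ (m / 2)) at prim i
... | suc _ = (+ (m / 2)) at prim j

module Submission where

-- Both come from one structural fact: ≻ is a strict total order on coloured
-- parts, i.e. ¬ (x ≻ y) ⇔ y ⪰ x, and dually ¬ (x ⪰ y) ⇔ y ≻ x.
--
-- Since x ≻ y only depends on the difference of the sizes,
-- a primary part on the left of ≫ can be traded for a part one unit smaller
-- on the right of ≻; this proves (i) and (ii) for arbitrary integer sizes.
-- Finally α(k_q) and β((k+1)_q) are the same part, and the lemma follows.

open import Defs
open import Data.Nat using (ℕ; suc; _≤_)
open import Data.Integer using (+_; _-_)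
open import Data.Fin as Fin using (Fin)
open import Data.Product using (_×_)
open import Function.Bundles using (_⇔_)
open import Relation.Nullary using (¬_)

open import Data.Bool using (true; false; T; _∨_; _∧_)
open import Data.Bool.Properties using (T-∨; T-∧)
open import Data.Empty using (⊥-elim)
open import Data.Fin.Properties using (toℕ-injective; toℕ<n)
open import Data.Integer as ℤ using (ℤ)
import Data.Integer.Properties as ℤ
open import Data.Integer.Tactic.RingSolver using (solve-∀)
open import Data.Nat as ℕ using (_<_; s≤s; z≤n; _≤ᵇ_; _<ᵇ_; _≡ᵇ_)
import Data.Nat.Properties as ℕ
open import Data.Nat.DivMod using (_/_; _%_; m/n≡1+[m∸n]/n)
open import Data.Product using (_,_; proj₁; proj₂)
import Data.Product as Product
open import Data.Product.Relation.Binary.Lex.Strict using (×-Lex; ×-compare)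
open import Data.Sum using (inj₁; inj₂; [_,_])
import Data.Sum as Sum
open import Function using (_∘_)
open import Function.Bundles using (mk⇔; Equivalence)
open import Function.Properties.Equivalence using ()
  renaming (trans to ⇔-trans; sym to ⇔-sym)
open import Function.Related.TypeIsomorphisms using (¬-cong-⇔)
open import Relation.Binary.Definitions using (tri<; tri≈; tri>)
open import Relation.Binary.PropositionalEquality using (_≡_; _≢_; refl; sym; trans; cong; subst)
open import Relation.Nullary using (Dec)
open import Relation.Nullary.Decidable using (decidable-stable)

open Equivalence using (to; from)

private
  variable
    n : ℕ
    u v : Color n
    a b : ℤ

_≤ˡᵉˣ_ _<ˡᵉˣ_ : ℕ × ℕ → ℕ × ℕ → Set
_≤ˡᵉˣ_ = ×-Lex _≡_ _<_ _≤_
_<ˡᵉˣ_ = ×-Lex _≡_ _<_ _<_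

≤ᶜ-reflects : (u v : Color n) → T (u ≤ᶜ v) ⇔ (key u ≤ˡᵉˣ key v)
≤ᶜ-reflects u v = lexᵇ-reflects (key u) (key v)
  where
  lexᵇ-reflects : ∀ ((c , d) (e , f) : ℕ × ℕ) →
    T ((c <ᵇ e) ∨ ((c ≡ᵇ e) ∧ (d ≤ᵇ f))) ⇔ ((c , d) ≤ˡᵉˣ (e , f))
  lexᵇ-reflects (c , d) (e , f) = mk⇔
    (Sum.map (ℕ.<ᵇ⇒< c e) (Product.map (ℕ.≡ᵇ⇒≡ c e) (ℕ.≤ᵇ⇒≤ d f) ∘ to T-∧) ∘ to T-∨)
    (from T-∨ ∘ Sum.map ℕ.<⇒<ᵇ (from T-∧ ∘ Product.map (ℕ.≡⇒≡ᵇ c e) ℕ.≤⇒≤ᵇ))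

<ˡᵉˣ⇒≤ˡᵉˣ : ∀ {s t} → s <ˡᵉˣ t → s ≤ˡᵉˣ t
<ˡᵉˣ⇒≤ˡᵉˣ = Sum.map₂ (Product.map₂ ℕ.<⇒≤)

<ˡᵉˣ⇒≱ˡᵉˣ : ∀ {s t} → s <ˡᵉˣ t → ¬ (t ≤ˡᵉˣ s)
<ˡᵉˣ⇒≱ˡᵉˣ (inj₁ c<e)         (inj₁ e<c)       = ℕ.<-asym c<e e<c
<ˡᵉˣ⇒≱ˡᵉˣ (inj₁ c<e)         (inj₂ (e≡c , _)) = ℕ.<-irrefl (sym e≡c) c<e
<ˡᵉˣ⇒≱ˡᵉˣ (inj₂ (c≡e , _))   (inj₁ e<c)       = ℕ.<-irrefl (sym c≡e) e<c
<ˡᵉˣ⇒≱ˡᵉˣ (inj₂ (_ , d<f))   (inj₂ (_ , f≤d)) = ℕ.<⇒≱ d<f f≤d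

key-injective : proj₁ (key u) ≡ proj₁ (key v) × proj₂ (key u) ≡ proj₂ (key v) → u ≡ v
key-injective {u = prim i}    {prim i'}      (i≡i' , _) = cong prim (toℕ-injective i≡i')
key-injective {u = prim _}    {sec _ j' _}   (_ , n≡j') = ⊥-elim (ℕ.<-irrefl (sym n≡j') (toℕ<n j'))
key-injective {u = sec _ j _} {prim _}       (_ , j≡n)  = ⊥-elim (ℕ.<-irrefl j≡n (toℕ<n j))
key-injective {u = sec i j h} {sec i' j' h'} (i≡i' , j≡j')
  with toℕ-injective i≡i' | toℕ-injective j≡j'
... | refl | refl = cong (sec i j) (ℕ.<-irrelevant h h')

data Comparison {n} (u v : Color n) : Set where
  same   : u ≡ v → Comparison u v
  before : T (u ≤ᶜ v) → ¬ T (v ≤ᶜ u) → Comparison u v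
  after  : ¬ T (u ≤ᶜ v) → T (v ≤ᶜ u) → Comparison u v

compareᶜ : (u v : Color n) → Comparison u v
compareᶜ u v with ×-compare sym ℕ.<-cmp ℕ.<-cmp (key u) (key v)
... | tri< u<v _ _ = before (from (≤ᶜ-reflects u v) (<ˡᵉˣ⇒≤ˡᵉˣ u<v))
                            (<ˡᵉˣ⇒≱ˡᵉˣ u<v ∘ to (≤ᶜ-reflects v u))
... | tri≈ _ u≈v _ = same (key-injective u≈v)
... | tri> _ _ v<u = after (<ˡᵉˣ⇒≱ˡᵉˣ v<u ∘ to (≤ᶜ-reflects u v))
                           (from (≤ᶜ-reflects v u) (<ˡᵉˣ⇒≤ˡᵉˣ v<u))

≤ᶜ-refl : (u : Color n) → T (u ≤ᶜ u)
≤ᶜ-refl u = from (≤ᶜ-reflects u u) (inj₂ (refl , ℕ.≤-refl))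

≤-minus⇔ : ∀ {c} → (c ℤ.≤ a - b) ⇔ (c ℤ.+ b ℤ.≤ a)
≤-minus⇔ {a} {b} {c} = mk⇔
  (λ c≤a-b → subst (c ℤ.+ b ℤ.≤_) (minus-plus a b) (ℤ.+-monoˡ-≤ b c≤a-b))
  (λ c+b≤a → subst (ℤ._≤ a - b) (plus-minus c b) (ℤ.+-monoˡ-≤ (ℤ.- b) c+b≤a))
  where
  minus-plus : ∀ a b → (a - b) ℤ.+ b ≡ a
  minus-plus = solve-∀
  plus-minus : ∀ c b → (c ℤ.+ b) - b ≡ c
  plus-minus = solve-∀

≻⇔-ordered : (x y : Part n) → T (color x ≤ᶜ color y) → (x ≻ y) ⇔ (size y ℤ.< size x)
≻⇔-ordered (a at u) (b at v) u≤v with u ≤ᶜ v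
... | true = ⇔-trans ≤-minus⇔ (mk⇔ ℤ.suc[i]≤j⇒i<j ℤ.i<j⇒suc[i]≤j)

≻⇔-unordered : (x y : Part n) → ¬ T (color x ≤ᶜ color y) → (x ≻ y) ⇔ (size y ℤ.≤ size x)
≻⇔-unordered (a at u) (b at v) u≰v with u ≤ᶜ v
... | true  = ⊥-elim (u≰v _)
... | false = mk⇔ ℤ.0≤i-j⇒j≤i ℤ.i≤j⇒0≤j-i

≻-difference : (u v : Color n) (a b a' b' : ℤ) → a - b ≡ a' - b' →
  ((a at u) ≻ (b at v)) ⇔ ((a' at u) ≻ (b' at v))
≻-difference u v _ _ _ _ d≡d' = mk⇔ (subst (χ u v ℤ.≤_) d≡d') (subst (χ u v ℤ.≤_) (sym d≡d'))

≻-asym : (x y : Part n) → x ≻ y → ¬ (y ≻ x)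
≻-asym x@(a at u) y@(b at v) x≻y y≻x with compareᶜ u v
... | same refl      = ℤ.<-asym (to (≻⇔-ordered x y (≤ᶜ-refl u)) x≻y)
                               (to (≻⇔-ordered y x (≤ᶜ-refl u)) y≻x)
... | before u≤v v≰u = ℤ.<⇒≱ (to (≻⇔-ordered x y u≤v) x≻y)
                             (to (≻⇔-unordered y x v≰u) y≻x)
... | after u≰v v≤u  = ℤ.<⇒≱ (to (≻⇔-ordered y x v≤u) y≻x)
                             (to (≻⇔-unordered x y u≰v) x≻y)

≻-connex : (x y : Part n) → ¬ (x ≻ y) → y ⪰ x
≻-connex x@(a at u) y@(b at v) x⊁y with compareᶜ u v
... | before u≤v v≰u =
  inj₁ (from (≻⇔-unordered y x v≰u) (ℤ.≮⇒≥ (x⊁y ∘ from (≻⇔-ordered x y u≤v))))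
... | after u≰v v≤u  =
  inj₁ (from (≻⇔-ordered y x v≤u) (ℤ.≰⇒> (x⊁y ∘ from (≻⇔-unordered x y u≰v))))
... | same refl with ℤ.<-cmp a b
...   | tri< a<b _ _ = inj₁ (from (≻⇔-ordered y x (≤ᶜ-refl u)) a<b)
...   | tri≈ _ refl _ = inj₂ refl
...   | tri> _ _ b<a = ⊥-elim (x⊁y (from (≻⇔-ordered x y (≤ᶜ-refl u)) b<a))

≻-dual : (x y : Part n) → (¬ (x ≻ y)) ⇔ (y ⪰ x)
≻-dual x y = mk⇔ (≻-connex x y)
  [ (λ y≻x x≻y → ≻-asym x y x≻y y≻x)
  , (λ { refl x≻x → ≻-asym x x x≻x x≻x }) ]

≻-dec : (x y : Part n) → Dec (x ≻ y)
≻-dec (a at u) (b at v) = χ u v ℤ.≤? (a - b)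

⪰-dual : (x y : Part n) → (¬ (x ⪰ y)) ⇔ (y ≻ x)
⪰-dual x y = mk⇔
  (λ x⋡y → decidable-stable (≻-dec y x) (x⋡y ∘ to (≻-dual y x)))
  (λ y≻x x⪰y → from (≻-dual y x) x⪰y y≻x)

⪰⇔≻ : (x y : Part n) → color x ≢ color y → (x ⪰ y) ⇔ (x ≻ y)
⪰⇔≻ x y u≢v = mk⇔ [ (λ x≻y → x≻y) , (λ x≡y → ⊥-elim (u≢v (cong color x≡y))) ] inj₁

-- l_p ≫ y says l_p ⪰ y + 1; by duality and a shift of one unit this is
-- the statement that y does not exceed (l-1)_p.
primary-≫ : (a : ℤ) (p : Fin n) (y : Part n) →
  ((a at prim p) ≫ y) ⇔ (¬ (y ≻ ((a - + 1) at prim p)))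
primary-≫ a p y@(b at q) =
  ⇔-trans (⇔-sym (≻-dual ((b ℤ.+ + 1) at q) (a at prim p)))
          (¬-cong-⇔ (≻-difference q (prim p) (b ℤ.+ + 1) a b (a - + 1) (shift-difference a b)))
  where
  shift-difference : ∀ a b → (b ℤ.+ + 1) - a ≡ b - (a - + 1)
  shift-difference = solve-∀

-- Part (i) for arbitrary sizes: against a secondary part, l_p ≫ k_q fails
-- exactly when (k+1)_q ≫ (l-1)_p.  Both sides say (k+1)_q ≻ l_p, since
-- parts of different colours are never equal.
primary-secondary-duality : (a : ℤ) (p : Fin n) (b : ℤ) (i j : Fin n) (h : i Fin.< j) →
  (¬ ((a at prim p) ≫ (b at sec i j h))) ⇔ ((ℤ.suc b at sec i j h) ≫ ((a - + 1) at prim p))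
primary-secondary-duality a p b i j h =
  ⇔-trans (⪰-dual (a at prim p) ((b ℤ.+ + 1) at sec i j h))
    (⇔-trans (≻-difference (sec i j h) (prim p) (b ℤ.+ + 1) a (ℤ.suc b) ((a - + 1) ℤ.+ + 1)
                                (shift-difference a b))
             (⇔-sym (⪰⇔≻ (ℤ.suc b at sec i j h) (((a - + 1) ℤ.+ + 1) at prim p) λ ())))
  where
  shift-difference : ∀ a b → (b ℤ.+ + 1) - a ≡ (+ 1 ℤ.+ b) - ((a - + 1) ℤ.+ + 1)
  shift-difference = solve-∀

half-of-2+ : ∀ m → (2 ℕ.+ m) / 2 ≡ suc (m / 2)
half-of-2+ m = m/n≡1+[m∸n]/n {m = 2 ℕ.+ m} {n = 2} (s≤s (s≤s z≤n))

data HalvingStep (k : ℕ) : Set where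
  from-even : k % 2 ≡ 0 → suc k % 2 ≡ 1 → suc k / 2 ≡ k / 2 → HalvingStep k
  from-odd  : k % 2 ≡ 1 → suc k % 2 ≡ 0 → suc k / 2 ≡ suc (k / 2) → HalvingStep k

halving-step : ∀ k → HalvingStep k
halving-step 0 = from-even refl refl refl
halving-step 1 = from-odd refl refl refl
halving-step (suc (suc k)) with halving-step k
... | from-even k-even sk-odd half = from-even k-even sk-odd
        (trans (half-of-2+ (suc k)) (trans (cong suc half) (sym (half-of-2+ k))))
... | from-odd k-odd sk-even half = from-odd k-odd sk-even
        (trans (half-of-2+ (suc k)) (cong suc (trans half (sym (half-of-2+ k)))))

α≡β-suc : ∀ k (i j : Fin n) → α k i j ≡ β (suc k) i j
α≡β-suc k i j with halving-step k
... | from-even k-even sk-odd half rewrite k-even | sk-odd | half = refl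
... | from-odd k-odd sk-even half rewrite k-odd | sk-even | half = refl

lemma2p1 : ∀ {n : ℕ} (l : ℕ) (p : Fin n) (k : ℕ) (i j : Fin n) (h : i Fin.< j) →
    1 ≤ l → 2 ≤ k →
    ((¬ (((+ l) at prim p) ≫ ((+ k) at sec i j h)))
        ⇔ (((+ suc k) at sec i j h) ≫ ((+ l - + 1) at prim p)))
    × ((((+ l) at prim p) ≫ α k i j)
        ⇔ (¬ (β (suc k) i j ≻ ((+ l - + 1) at prim p))))
lemma2p1 l p k i j h _ _ =
    primary-secondary-duality (+ l) p (+ k) i j h
  , subst (λ y → (((+ l) at prim p) ≫ α k i j) ⇔ (¬ (y ≻ ((+ l - + 1) at prim p))))
          (α≡β-suc k i j)
          (primary-≫ (+ l) p (α k i j))
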